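{- If $n_1\geq n_2\geq n_3$ are integers with $n_3\in \{2,3\}$, then $\mu_{\rm t}(K_{n_1}\,\square\, K_{n_2}\,\square\, K_{n_3}) = n_1+n_2-2$.
   Context: For a connected graph $G$ and $X\subseteq V(G)$, two vertices $x,y$ are $X$-visible if there is a shortest $x,y$-path none of whose internal vertices lies in $X$. $X$ is a total mutual-visibility set if every two vertices of $V(G)$ are $X$-visible. $\mu_{\rm t}(G)$ is the maximum cardinality of a total mutual-visibility set of $G$. $\square$ denotes the Cartesian product of graphs and $K_n$ the complete graph on $n$ vertices. -}

module Defs where

open import Data.Nat using (ℕ; zero; suc; _≤_)
open import Data.Fin using (Fin)
open import Data.Product using (_×_; _,_; ∃-syntax)
open import Data.Sum using (_⊎_)
open import Data.List using (List; []; _∷_; length)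
open import Data.List.Membership.Propositional using (_∈_)
open import Data.List.Relation.Unary.Unique.Propositional using (Unique)
open import Relation.Binary.PropositionalEquality using (_≡_; _≢_)
open import Relation.Nullary using (¬_)

record Graph : Set₁ where
  field
    V   : Set
    Adj : V → V → Set
open Graph public

K : ℕ → Graph
K n = record { V = Fin n ; Adj = λ i j → i ≢ j }

infixl 6 _□_
_□_ : Graph → Graph → Graph
G □ H = record
  { V   = V G × V H
  ; Adj = λ { (g , h) (g' , h') →
              (Adj G g g' × h ≡ h') ⊎ (g ≡ g' × Adj H h h') } }

module _ (G : Graph) where

  data Walk : V G → V G → Set where
    []  : ∀ {x} → Walk x x
    _∷_ : ∀ {x y z} → Adj G x y → Walk y z → Walk x z

  walkLength : ∀ {x y} → Walk x y → ℕ
  walkLength []      = zero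
  walkLength (_ ∷ w) = suc (walkLength w)

  internal : ∀ {x y} → Walk x y → List (V G)
  internal []                          = []
  internal (_ ∷ [])                    = []
  internal (_∷_ {y = y} _ (e ∷ w))     = y ∷ internal (e ∷ w)

  IsShortest : ∀ {x y} → Walk x y → Set
  IsShortest {x} {y} p = (q : Walk x y) → walkLength p ≤ walkLength q

  Visible : List (V G) → V G → V G → Set
  Visible X x y =
    ∃[ p ] (IsShortest {x} {y} p × (∀ v → v ∈ internal p → ¬ (v ∈ X)))

  IsTotalMutualVisibilitySet : List (V G) → Set
  IsTotalMutualVisibilitySet X = ∀ x y → Visible X x y

  TotalMutualVisibilityNumber : ℕ → Set
  TotalMutualVisibilityNumber m =
    (∃[ X ] (Unique X × IsTotalMutualVisibilitySet X × length X ≡ m))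
    × (∀ X → Unique X → IsTotalMutualVisibilitySet X → length X ≤ m)

{-# OPTIONS --safe #-}
module Submission where

-- Distance in K n₁ □ K n₂ □ K n₃ is Hamming distance. Two vertices agreeing in exactly one
-- coordinate are at distance two and have exactly two common neighbours, which again agree in
-- exactly one coordinate; conversely, if no two members of X agree in exactly one coordinate,
-- every pair of vertices is joined by a coordinate-by-coordinate shortest path avoiding X. So X is
-- a total mutual-visibility set iff no two of its members agree in exactly one coordinate.
--
-- For such X, members in a common layer (value of one coordinate) differ in just one of the other
-- two, and members of different layers differ everywhere. If X projects injectively onto two
-- coordinates, of sizes m and m', each layer lies on a line; the positions of the vertices on
-- their lines together with two values left unused (the constant coordinates of two lines, or of
-- a line and a spare value) are |X| + 2 distinct values among m + m'. When n₃ ≤ 3 such a pair of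
-- coordinates exists: an edge of X along the third coordinate occupies two of its values, so
-- edges of X along the other two coordinates would lie in one common layer, which is impossible.
-- The bound n₁ + n₂ − 2 is attained by {(i,0,0) | i ≠ 0} ∪ {(0,j,1) | j ≠ 0}.

open import Defs
open import Data.Nat using (ℕ; zero; suc; _≤_; _+_; _∸_; z≤n; s≤s)
open import Data.Nat.Properties
  using (≤-refl; ≤-reflexive; ≤-trans; <⇒≱; m≤m+n; +-suc; +-mono-≤; +-monoˡ-≤; +-monoʳ-≤; ∸-monoˡ-≤;
         module ≤-Reasoning)
open import Data.Fin using (Fin; zero; suc; join; splitAt; punchIn)
open import Data.Fin.Properties using (_≟_; suc-injective; splitAt-join; punchInᵢ≢i)
open import Data.Product using (_×_; _,_; ∃-syntax; proj₁; proj₂)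
open import Data.Sum using (_⊎_; inj₁; inj₂; [_,_]′)
open import Data.Sum.Properties using (inj₁-injective; inj₂-injective)
open import Data.Product.Properties using (≡-dec)
open import Data.List using (List; []; _∷_; length; map; allFin; _++_)
open import Data.List.Properties using (length-map; length-tabulate; length-removeAt′; length-++)
open import Data.List.Membership.Propositional using (_∈_; _∉_; find)
open import Data.List.Membership.Propositional.Properties using (∈-allFin; ∈-++⁻; ∈-map⁻)
open import Data.List.Relation.Unary.Any using (here; there; _─_)
open import Data.List.Relation.Unary.All as All using (All; []; _∷_; all?)
import Data.List.Relation.Unary.All.Properties as All
open import Data.List.Relation.Unary.AllPairs using ([]; _∷_)
open import Data.List.Relation.Unary.Unique.Propositional using (Unique)
open import Data.List.Relation.Unary.Unique.Propositional.Properties as Unique using (++⁺; allFin⁺)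
open import Data.Empty using (⊥; ⊥-elim)
open import Function using (_∘_; const; id)
open import Relation.Nullary using (¬_; Dec; yes; no; _→-dec_)
open import Relation.Binary.PropositionalEquality
  using (_≡_; _≢_; refl; sym; trans; cong; cong₂; subst; ≢-sym; module ≡-Reasoning)

private
  variable
    A B : Set
    m n : ℕ

∈-─⁺ : ∀ {x z} {ys : List A} (x∈ys : x ∈ ys) → z ∈ ys → z ≢ x → z ∈ (ys ─ x∈ys)
∈-─⁺ (here refl) (here refl) z≢x = ⊥-elim (z≢x refl)
∈-─⁺ (here refl) (there z∈ys) _  = z∈ys
∈-─⁺ (there x∈ys) (here refl) _  = here refl
∈-─⁺ (there x∈ys) (there z∈ys) z≢x = there (∈-─⁺ x∈ys z∈ys z≢x)

Unique⇒length≤ : {xs ys : List A} → Unique xs → (∀ {x} → x ∈ xs → x ∈ ys) → length xs ≤ length ys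
Unique⇒length≤ [] _ = z≤n
Unique⇒length≤ {xs = x ∷ xs} {ys} (x∉xs ∷ uxs) xs⊆ys = begin
  suc (length xs)          ≤⟨ s≤s (Unique⇒length≤ uxs xs⊆ys─x) ⟩
  suc (length (ys ─ x∈ys)) ≡⟨ length-removeAt′ ys _ ⟨
  length ys                ∎
  where
  open ≤-Reasoning
  x∈ys : x ∈ ys
  x∈ys = xs⊆ys (here refl)
  xs⊆ys─x : ∀ {z} → z ∈ xs → z ∈ (ys ─ x∈ys)
  xs⊆ys─x z∈xs = ∈-─⁺ x∈ys (xs⊆ys (there z∈xs)) (≢-sym (All.lookup x∉xs z∈xs))

Fin-Unique⇒length≤ : {xs : List (Fin n)} → Unique xs → length xs ≤ n
Fin-Unique⇒length≤ {n} uxs =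
  ≤-trans (Unique⇒length≤ uxs (λ {x} _ → ∈-allFin x)) (≤-reflexive (length-tabulate {n = n} id))

⊎-Unique⇒length≤ : {xs : List (Fin m ⊎ Fin n)} → Unique xs → length xs ≤ m + n
⊎-Unique⇒length≤ {m} {n} {xs} uxs = begin
  length xs                  ≡⟨ length-map (join m n) xs ⟨
  length (map (join m n) xs) ≤⟨ Fin-Unique⇒length≤ (Unique.map⁺ join-injective uxs) ⟩
  m + n                      ∎
  where
  open ≤-Reasoning
  join-injective : ∀ {a b} → join m n a ≡ join m n b → a ≡ b
  join-injective {a} {b} e =
    trans (sym (splitAt-join m n a)) (trans (cong (splitAt m) e) (splitAt-join m n b))

Unique-map⁺-on : ∀ {f : A → B} {xs} → (∀ {x y} → x ∈ xs → y ∈ xs → f x ≡ f y → x ≡ y) →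
  Unique xs → Unique (map f xs)
Unique-map⁺-on _   []            = []
Unique-map⁺-on inj (x∉xs ∷ uxs) =
  All.map⁺ (All.tabulate λ y∈xs fx≡fy → All.lookup x∉xs y∈xs (inj (here refl) (there y∈xs) fx≡fy))
  ∷ Unique-map⁺-on (λ x∈xs y∈xs → inj (there x∈xs) (there y∈xs)) uxs

[]⊎∈ : (xs : List A) → xs ≡ [] ⊎ ∃[ x ] x ∈ xs
[]⊎∈ []       = inj₁ refl
[]⊎∈ (x ∷ xs) = inj₂ (x , here refl)

another : 2 ≤ n → (a : Fin n) → ∃[ b ] b ≢ a
another {suc (suc _)} _ a = punchIn a zero , punchInᵢ≢i a zero
another {suc zero} (s≤s ())

outside-pair-unique : n ≤ 3 → {x y z z' : Fin n} → x ≢ y →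
  z ≢ x → z ≢ y → z' ≢ x → z' ≢ y → z ≡ z'
outside-pair-unique n≤3 {x} {y} {z} {z'} x≢y z≢x z≢y z'≢x z'≢y with z ≟ z'
... | yes z≡z' = z≡z'
... | no  z≢z' = ⊥-elim (<⇒≱ (s≤s n≤3) (Fin-Unique⇒length≤ distinct))
  where
  distinct : Unique (x ∷ y ∷ z ∷ z' ∷ [])
  distinct = (x≢y ∷ ≢-sym z≢x ∷ ≢-sym z'≢x ∷ []) ∷ (≢-sym z≢y ∷ ≢-sym z'≢y ∷ []) ∷ (z≢z' ∷ []) ∷ []
           ∷ []

dec-¬→ : ∀ {P Q : Set} → Dec P → ¬ (P → Q) → P × ¬ Q
dec-¬→ (yes p) ¬[p→q] = p , ¬[p→q] ∘ const
dec-¬→ (no ¬p) ¬[p→q] = ⊥-elim (¬[p→q] (⊥-elim ∘ ¬p))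

record DistanceLowerBound (G : Graph) : Set where
  field
    dist      : V G → V G → ℕ
    dist-refl : ∀ x → dist x x ≡ 0
    dist-step : ∀ {x z} y → Adj G x z → dist x y ≤ suc (dist z y)

  dist≤walkLength : ∀ {x y} (p : Walk G x y) → dist x y ≤ walkLength G p
  dist≤walkLength {x} [] = ≤-reflexive (dist-refl x)
  dist≤walkLength {y = y} (e ∷ p) = ≤-trans (dist-step y e) (s≤s (dist≤walkLength p))

  isShortest : ∀ {x y} (p : Walk G x y) → walkLength G p ≤ dist x y → IsShortest G p
  isShortest p p≤dist q = ≤-trans p≤dist (dist≤walkLength q)

open DistanceLowerBound

δ : Fin n → Fin n → ℕ
δ a b with a ≟ b
... | yes _ = 0
... | no  _ = 1

δ-refl : (a : Fin n) → δ a a ≡ 0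
δ-refl a with a ≟ a
... | yes _  = refl
... | no a≢a = ⊥-elim (a≢a refl)

δ-≢ : {a b : Fin n} → a ≢ b → 1 ≤ δ a b
δ-≢ {a = a} {b} a≢b with a ≟ b
... | yes a≡b = ⊥-elim (a≢b a≡b)
... | no  _   = s≤s z≤n

δ≤1 : (a b : Fin n) → δ a b ≤ 1
δ≤1 a b with a ≟ b
... | yes _ = z≤n
... | no  _ = s≤s z≤n

K-distance : DistanceLowerBound (K n)
K-distance = record
  { dist      = δ
  ; dist-refl = δ-refl
  ; dist-step = λ {x} y _ → ≤-trans (δ≤1 x y) (s≤s z≤n)
  }

module _ {G H : Graph} (dG : DistanceLowerBound G) (dH : DistanceLowerBound H) where

  □-dist : V (G □ H) → V (G □ H) → ℕ
  □-dist (g , h) (g' , h') = dist dG g g' + dist dH h h'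

  □-dist-step : ∀ {x z} y → Adj (G □ H) x z → □-dist x y ≤ suc (□-dist z y)
  □-dist-step (g' , h') (inj₁ (g~z , refl)) = +-monoˡ-≤ _ (dist-step dG g' g~z)
  □-dist-step {g , h} (g' , h') (inj₂ (refl , h~z)) =
    ≤-trans (+-monoʳ-≤ (dist dG g g') (dist-step dH h' h~z)) (≤-reflexive (+-suc _ _))

  □-distance : DistanceLowerBound (G □ H)
  □-distance = record
    { dist      = □-dist
    ; dist-refl = λ { (g , h) → cong₂ _+_ (dist-refl dG g) (dist-refl dH h) }
    ; dist-step = □-dist-step
    }

¬visible-via-common-neighbours :
  ∀ {G X x u y} → x ≢ y → ¬ Adj G x y → Adj G x u → Adj G u y →
  (∀ {z} → Adj G x z → Adj G z y → z ∈ X) → ¬ Visible G X x y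
¬visible-via-common-neighbours x≢y _ _ _ _ ([] , _ , _) = x≢y refl
¬visible-via-common-neighbours _ x≁y _ _ _ ((x~y ∷ []) , _ , _) = x≁y x~y
¬visible-via-common-neighbours _ _ _ _ common ((x~z ∷ z~y ∷ []) , _ , avoids) =
  avoids _ (here refl) (common x~z z~y)
¬visible-via-common-neighbours _ _ x~u u~y _ ((_ ∷ _ ∷ _ ∷ _) , shortest , _)
  with shortest (x~u ∷ u~y ∷ [])
... | s≤s (s≤s ())

module _ {G H : Graph} where

  □-¬adj : ∀ {g g' h h'} → g ≢ g' → h ≢ h' → ¬ Adj (G □ H) (g , h) (g' , h')
  □-¬adj _ h≢h' (inj₁ (_ , h≡h')) = h≢h' h≡h'
  □-¬adj g≢g' _ (inj₂ (g≡g' , _)) = g≢g' g≡g'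

  □-¬adj-layer : ∀ {g g' h} → g ≢ g' → ¬ Adj G g g' → ¬ Adj (G □ H) (g , h) (g' , h)
  □-¬adj-layer _ g≁g' (inj₁ (g~g' , _)) = g≁g' g~g'
  □-¬adj-layer g≢g' _ (inj₂ (g≡g' , _)) = g≢g' g≡g'

  □-common-neighbour : ∀ {g g' h h' z} → g ≢ g' → h ≢ h' →
    Adj (G □ H) (g , h') z → Adj (G □ H) z (g' , h) → z ≡ (g , h) ⊎ z ≡ (g' , h')
  □-common-neighbour _ h≢h' (inj₁ (_ , refl)) (inj₁ (_ , h'≡h)) = ⊥-elim (h≢h' (sym h'≡h))
  □-common-neighbour _ _    (inj₁ (_ , refl)) (inj₂ (refl , _)) = inj₂ refl
  □-common-neighbour _ _    (inj₂ (refl , _)) (inj₁ (_ , refl)) = inj₁ refl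
  □-common-neighbour g≢g' _ (inj₂ (refl , _)) (inj₂ (g≡g' , _)) = ⊥-elim (g≢g' g≡g')

  □-common-neighbour-layer : ∀ {g g' h z} → g ≢ g' → ¬ Adj G g g' →
    Adj (G □ H) (g , h) z → Adj (G □ H) z (g' , h) →
    ∃[ z' ] (z ≡ (z' , h) × Adj G g z' × Adj G z' g')
  □-common-neighbour-layer _ _ (inj₁ (g~z' , refl)) (inj₁ (z'~g' , refl)) = _ , refl , g~z' , z'~g'
  □-common-neighbour-layer _ g≁g' (inj₁ (g~g' , refl)) (inj₂ (refl , _)) = ⊥-elim (g≁g' g~g')
  □-common-neighbour-layer _ g≁g' (inj₂ (refl , _)) (inj₁ (g~g' , _)) = ⊥-elim (g≁g' g~g')
  □-common-neighbour-layer g≢g' _ (inj₂ (refl , _)) (inj₂ (g≡g' , _)) = ⊥-elim (g≢g' g≡g')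

  □-corners-invisible : ∀ {X g g' h h'} → Adj G g g' → Adj H h' h → g ≢ g' → h ≢ h' →
    (g , h) ∈ X → (g' , h') ∈ X → ¬ Visible (G □ H) X (g , h') (g' , h)
  □-corners-invisible {X} {g} {g'} {h} {h'} g~g' h'~h g≢g' h≢h' gh∈X g'h'∈X =
    ¬visible-via-common-neighbours (g≢g' ∘ cong proj₁) (□-¬adj g≢g' (≢-sym h≢h'))
      (inj₂ (refl , h'~h)) (inj₁ (g~g' , refl))
      (λ x~z z~y → corner∈X (□-common-neighbour g≢g' h≢h' x~z z~y))
    where
    corner∈X : ∀ {z} → z ≡ (g , h) ⊎ z ≡ (g' , h') → z ∈ X
    corner∈X (inj₁ refl) = gh∈X
    corner∈X (inj₂ refl) = g'h'∈X

data ExactlyOne (P Q R : Set) : Set where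
  only₁ : P → ¬ Q → ¬ R → ExactlyOne P Q R
  only₂ : ¬ P → Q → ¬ R → ExactlyOne P Q R
  only₃ : ¬ P → ¬ Q → R → ExactlyOne P Q R

ExactlyOne-swap₂₃ : ∀ {P Q R} → ExactlyOne P R Q → ExactlyOne P Q R
ExactlyOne-swap₂₃ (only₁ p ¬r ¬q) = only₁ p ¬q ¬r
ExactlyOne-swap₂₃ (only₂ ¬p r ¬q) = only₃ ¬p ¬q r
ExactlyOne-swap₂₃ (only₃ ¬p ¬r q) = only₂ ¬p q ¬r

ExactlyOne-rotate : ∀ {P Q R} → ExactlyOne Q R P → ExactlyOne P Q R
ExactlyOne-rotate (only₁ q ¬r ¬p) = only₂ ¬p q ¬r
ExactlyOne-rotate (only₂ ¬q r ¬p) = only₃ ¬p ¬q r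
ExactlyOne-rotate (only₃ ¬q ¬r p) = only₁ p ¬q ¬r

module _ {V : Set} {m₁ m₂ m₃ : ℕ} (f₁ : V → Fin m₁) (f₂ : V → Fin m₂) (f₃ : V → Fin m₃)
         (X : List V) where

  NoSingleAgreement : Set
  NoSingleAgreement = ∀ {u w} → u ∈ X → w ∈ X → ¬ ExactlyOne (f₁ u ≡ f₁ w) (f₂ u ≡ f₂ w) (f₃ u ≡ f₃ w)

  EdgeAlong : Set
  EdgeAlong = ∃[ u ] ∃[ w ] (u ∈ X × w ∈ X × f₁ u ≡ f₁ w × f₂ u ≡ f₂ w × f₃ u ≢ f₃ w)

  NoEdgeAlong : Set
  NoEdgeAlong = ∀ {u w} → u ∈ X → w ∈ X → f₁ u ≡ f₁ w → f₂ u ≡ f₂ w → f₃ u ≡ f₃ w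

  private
    edgeFree? : ∀ u w → Dec (f₁ u ≡ f₁ w → f₂ u ≡ f₂ w → f₃ u ≡ f₃ w)
    edgeFree? u w = (f₁ u ≟ f₁ w) →-dec ((f₂ u ≟ f₂ w) →-dec (f₃ u ≟ f₃ w))

  noEdgeAlong-or-edgeAlong : NoEdgeAlong ⊎ EdgeAlong
  noEdgeAlong-or-edgeAlong with all? (λ u → all? (edgeFree? u) X) X
  ... | yes free = inj₁ (λ u∈X w∈X → All.lookup (All.lookup free u∈X) w∈X)
  ... | no ¬free =
    let u , u∈X , ¬free-u = find (All.¬All⇒Any¬ (λ u → all? (edgeFree? u) X) X ¬free)
        w , w∈X , ¬free-uw = find (All.¬All⇒Any¬ (edgeFree? u) X ¬free-u)
        e₁ , ¬[e₂→e₃] = dec-¬→ (f₁ u ≟ f₁ w) ¬free-uw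
        e₂ , ¬e₃ = dec-¬→ (f₂ u ≟ f₂ w) ¬[e₂→e₃]
    in inj₂ (u , w , u∈X , w∈X , e₁ , e₂ , ¬e₃)

NoSingleAgreement-swap₂₃ : ∀ {V m₁ m₂ m₃} {f₁ : V → Fin m₁} {f₂ : V → Fin m₂} {f₃ : V → Fin m₃} {X} →
  NoSingleAgreement f₁ f₂ f₃ X → NoSingleAgreement f₁ f₃ f₂ X
NoSingleAgreement-swap₂₃ free u∈X w∈X = free u∈X w∈X ∘ ExactlyOne-swap₂₃

NoSingleAgreement-rotate : ∀ {V m₁ m₂ m₃} {f₁ : V → Fin m₁} {f₂ : V → Fin m₂} {f₃ : V → Fin m₃} {X} →
  NoSingleAgreement f₁ f₂ f₃ X → NoSingleAgreement f₂ f₃ f₁ X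
NoSingleAgreement-rotate free u∈X w∈X = free u∈X w∈X ∘ ExactlyOne-rotate

module NoSingleAgreementProperties {V : Set} {m₁ m₂ m₃ : ℕ}
  {f₁ : V → Fin m₁} {f₂ : V → Fin m₂} {f₃ : V → Fin m₃} {X : List V}
  (free : NoSingleAgreement f₁ f₂ f₃ X) where

  sameLayer-≢₁⇒≡₂ : ∀ {u w} → u ∈ X → w ∈ X → f₃ u ≡ f₃ w → f₁ u ≢ f₁ w → f₂ u ≡ f₂ w
  sameLayer-≢₁⇒≡₂ {u} {w} u∈X w∈X u₃≡w₃ u₁≢w₁ with f₂ u ≟ f₂ w
  ... | yes u₂≡w₂ = u₂≡w₂
  ... | no  u₂≢w₂ = ⊥-elim (free u∈X w∈X (only₃ u₁≢w₁ u₂≢w₂ u₃≡w₃))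

  sameLayer-≢₂⇒≡₁ : ∀ {u w} → u ∈ X → w ∈ X → f₃ u ≡ f₃ w → f₂ u ≢ f₂ w → f₁ u ≡ f₁ w
  sameLayer-≢₂⇒≡₁ {u} {w} u∈X w∈X u₃≡w₃ u₂≢w₂ with f₁ u ≟ f₁ w
  ... | yes u₁≡w₁ = u₁≡w₁
  ... | no  u₁≢w₁ = ⊥-elim (free u∈X w∈X (only₃ u₁≢w₁ u₂≢w₂ u₃≡w₃))

  edgeEnd-layer : ∀ {u w r} → u ∈ X → w ∈ X → f₁ u ≡ f₁ w → f₂ u ≡ f₂ w → f₃ u ≢ f₃ w →
    r ∈ X → f₃ r ≡ f₃ u → f₁ r ≡ f₁ u × f₂ r ≡ f₂ u
  edgeEnd-layer {u} {w} {r} u∈X w∈X u₁≡w₁ u₂≡w₂ u₃≢w₃ r∈X r₃≡u₃ with f₁ r ≟ f₁ u | f₂ r ≟ f₂ u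
  ... | yes r₁≡u₁ | yes r₂≡u₂ = r₁≡u₁ , r₂≡u₂
  ... | yes r₁≡u₁ | no  r₂≢u₂ =
    ⊥-elim (free r∈X w∈X (only₁ (trans r₁≡u₁ u₁≡w₁) (λ r₂≡w₂ → r₂≢u₂ (trans r₂≡w₂ (sym u₂≡w₂)))
                                (u₃≢w₃ ∘ trans (sym r₃≡u₃))))
  ... | no  r₁≢u₁ | yes r₂≡u₂ =
    ⊥-elim (free r∈X w∈X (only₂ (λ r₁≡w₁ → r₁≢u₁ (trans r₁≡w₁ (sym u₁≡w₁))) (trans r₂≡u₂ u₂≡w₂)
                                (u₃≢w₃ ∘ trans (sym r₃≡u₃))))
  ... | no  r₁≢u₁ | no  r₂≢u₂ = ⊥-elim (free r∈X u∈X (only₃ r₁≢u₁ r₂≢u₂ r₃≡u₃))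

  no-three-edge-directions : m₃ ≤ 3 →
    EdgeAlong f₁ f₂ f₃ X → EdgeAlong f₁ f₃ f₂ X → EdgeAlong f₂ f₃ f₁ X → ⊥
  no-three-edge-directions m₃≤3
    (u , w , u∈X , w∈X , u₁≡w₁ , u₂≡w₂ , u₃≢w₃)
    (s , t , s∈X , t∈X , s₁≡t₁ , s₃≡t₃ , s₂≢t₂)
    (p , q , p∈X , q∈X , p₂≡q₂ , p₃≡q₃ , p₁≢q₁) = p-or-q (f₁ p ≟ f₁ s)
    where
    avoids-layer-of : ∀ {e} → (∀ {r} → r ∈ X → f₃ r ≡ f₃ e → f₁ r ≡ f₁ e × f₂ r ≡ f₂ e) →
      f₃ s ≢ f₃ e × f₃ p ≢ f₃ e
    avoids-layer-of layer-e =
        (λ s₃≡e₃ → s₂≢t₂ (trans (proj₂ (layer-e s∈X s₃≡e₃))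
                                (sym (proj₂ (layer-e t∈X (trans (sym s₃≡t₃) s₃≡e₃))))))
      , (λ p₃≡e₃ → p₁≢q₁ (trans (proj₁ (layer-e p∈X p₃≡e₃))
                                (sym (proj₁ (layer-e q∈X (trans (sym p₃≡q₃) p₃≡e₃))))))

    s₃≡p₃ : f₃ s ≡ f₃ p
    s₃≡p₃ =
      let s₃≢u₃ , p₃≢u₃ = avoids-layer-of (edgeEnd-layer u∈X w∈X u₁≡w₁ u₂≡w₂ u₃≢w₃)
          s₃≢w₃ , p₃≢w₃ = avoids-layer-of (edgeEnd-layer w∈X u∈X (sym u₁≡w₁) (sym u₂≡w₂) (≢-sym u₃≢w₃))
      in outside-pair-unique m₃≤3 u₃≢w₃ s₃≢u₃ s₃≢w₃ p₃≢u₃ p₃≢w₃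

    -- A member of the layer of s whose f₁ differs from that of s and t
    -- would share its f₂ with both of them.
    ¬off-s : ∀ {r} → r ∈ X → f₃ r ≡ f₃ s → f₁ r ≢ f₁ s → ⊥
    ¬off-s r∈X r₃≡s₃ r₁≢s₁ =
      s₂≢t₂ (trans (sym (sameLayer-≢₁⇒≡₂ r∈X s∈X r₃≡s₃ r₁≢s₁))
                   (sameLayer-≢₁⇒≡₂ r∈X t∈X (trans r₃≡s₃ s₃≡t₃)
                                    (λ r₁≡t₁ → r₁≢s₁ (trans r₁≡t₁ (sym s₁≡t₁)))))

    p-or-q : Dec (f₁ p ≡ f₁ s) → ⊥
    p-or-q (no  p₁≢s₁) = ¬off-s p∈X (sym s₃≡p₃) p₁≢s₁
    p-or-q (yes p₁≡s₁) =
      ¬off-s q∈X (trans (sym p₃≡q₃) (sym s₃≡p₃)) (λ q₁≡s₁ → p₁≢q₁ (trans p₁≡s₁ (sym q₁≡s₁)))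

  module _ (inj : ∀ {u w} → u ∈ X → w ∈ X → f₁ u ≡ f₁ w → f₂ u ≡ f₂ w → u ≡ w) where

    otherLayer-≢₁ : ∀ {u w} → u ∈ X → w ∈ X → f₃ u ≢ f₃ w → f₁ u ≢ f₁ w
    otherLayer-≢₁ {u} {w} u∈X w∈X u₃≢w₃ u₁≡w₁ with f₂ u ≟ f₂ w
    ... | yes u₂≡w₂ = u₃≢w₃ (cong f₃ (inj u∈X w∈X u₁≡w₁ u₂≡w₂))
    ... | no  u₂≢w₂ = free u∈X w∈X (only₁ u₁≡w₁ u₂≢w₂ u₃≢w₃)

    otherLayer-≢₂ : ∀ {u w} → u ∈ X → w ∈ X → f₃ u ≢ f₃ w → f₂ u ≢ f₂ w
    otherLayer-≢₂ {u} {w} u∈X w∈X u₃≢w₃ u₂≡w₂ with f₁ u ≟ f₁ w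
    ... | yes u₁≡w₁ = u₃≢w₃ (cong f₃ (inj u∈X w∈X u₁≡w₁ u₂≡w₂))
    ... | no  u₁≢w₁ = free u∈X w∈X (only₂ u₁≢w₁ u₂≡w₂ u₃≢w₃)

    -- Each layer of X lies on a line parallel to the f₁-axis (Horizontal) or to the f₂-axis;
    -- `varying` is a vertex's position on that line and `fixed` the coordinate constant along it.
    Horizontal : V → Set
    Horizontal v = All (λ t → f₃ t ≡ f₃ v → f₂ t ≡ f₂ v) X

    horizontal? : ∀ v → Dec (Horizontal v)
    horizontal? v = all? (λ t → (f₃ t ≟ f₃ v) →-dec (f₂ t ≟ f₂ v)) X

    ¬horizontal⇒witness : ∀ {v} → ¬ Horizontal v → ∃[ r ] (r ∈ X × f₃ r ≡ f₃ v × f₂ r ≢ f₂ v)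
    ¬horizontal⇒witness {v} ¬hv =
      let r , r∈X , ¬[r₃≡v₃→r₂≡v₂] = find (All.¬All⇒Any¬ (λ r → (f₃ r ≟ f₃ v) →-dec (f₂ r ≟ f₂ v)) X ¬hv)
      in r , r∈X , dec-¬→ (f₃ r ≟ f₃ v) ¬[r₃≡v₃→r₂≡v₂]

    horizontal-layer : ∀ {v t} → Horizontal v → t ∈ X → f₃ t ≡ f₃ v → Horizontal t
    horizontal-layer hv t∈X t₃≡v₃ = All.tabulate λ r∈X r₃≡t₃ →
      trans (All.lookup hv r∈X (trans r₃≡t₃ t₃≡v₃)) (sym (All.lookup hv t∈X t₃≡v₃))

    vertical-layer : ∀ {v t} → ¬ Horizontal v → v ∈ X → t ∈ X → f₃ t ≡ f₃ v → f₁ t ≡ f₁ v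
    vertical-layer {v} {t} ¬hv v∈X t∈X t₃≡v₃ with f₁ t ≟ f₁ v
    ... | yes t₁≡v₁ = t₁≡v₁
    ... | no  t₁≢v₁ =
      let r , r∈X , r₃≡v₃ , r₂≢v₂ = ¬horizontal⇒witness ¬hv
          r₁≡v₁ = sameLayer-≢₂⇒≡₁ r∈X v∈X r₃≡v₃ r₂≢v₂
          t₂≡v₂ = sameLayer-≢₁⇒≡₂ t∈X v∈X t₃≡v₃ t₁≢v₁
          t₂≡r₂ = sameLayer-≢₁⇒≡₂ t∈X r∈X (trans t₃≡v₃ (sym r₃≡v₃))
                                          (λ t₁≡r₁ → t₁≢v₁ (trans t₁≡r₁ r₁≡v₁))
      in ⊥-elim (r₂≢v₂ (trans (sym t₂≡r₂) t₂≡v₂))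

    varying : V → Fin m₁ ⊎ Fin m₂
    varying v with horizontal? v
    ... | yes _ = inj₁ (f₁ v)
    ... | no  _ = inj₂ (f₂ v)

    fixed : V → Fin m₁ ⊎ Fin m₂
    fixed v with horizontal? v
    ... | yes _ = inj₂ (f₂ v)
    ... | no  _ = inj₁ (f₁ v)

    varying-injective : ∀ {u w} → u ∈ X → w ∈ X → varying u ≡ varying w → u ≡ w
    varying-injective {u} {w} u∈X w∈X eq with horizontal? u | horizontal? w | f₃ w ≟ f₃ u
    varying-injective u∈X w∈X eq | yes hu | yes _ | yes w₃≡u₃ =
      inj u∈X w∈X (inj₁-injective eq) (sym (All.lookup hu w∈X w₃≡u₃))
    varying-injective u∈X w∈X eq | yes _ | yes _ | no w₃≢u₃ =
      ⊥-elim (otherLayer-≢₁ u∈X w∈X (≢-sym w₃≢u₃) (inj₁-injective eq))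
    varying-injective u∈X w∈X eq | no ¬hu | no _ | yes w₃≡u₃ =
      inj u∈X w∈X (sym (vertical-layer ¬hu u∈X w∈X w₃≡u₃)) (inj₂-injective eq)
    varying-injective u∈X w∈X eq | no _ | no _ | no w₃≢u₃ =
      ⊥-elim (otherLayer-≢₂ u∈X w∈X (≢-sym w₃≢u₃) (inj₂-injective eq))
    varying-injective u∈X w∈X () | yes _ | no _ | _
    varying-injective u∈X w∈X () | no _ | yes _ | _

    varying≢fixed : ∀ {u} → u ∈ X → ∀ {v} → v ∈ X → varying v ≢ fixed u
    varying≢fixed {u} u∈X {v} v∈X with horizontal? u | horizontal? v | f₃ v ≟ f₃ u
    ... | yes _  | yes _   | _         = λ ()
    ... | no _   | no _    | _         = λ ()
    ... | yes hu | no ¬hv  | yes v₃≡u₃ = λ _ → ¬hv (horizontal-layer hu v∈X v₃≡u₃)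
    ... | no ¬hu | yes hv  | yes v₃≡u₃ = λ _ → ¬hu (horizontal-layer hv u∈X (sym v₃≡u₃))
    ... | yes _  | no _    | no v₃≢u₃  = otherLayer-≢₂ v∈X u∈X v₃≢u₃ ∘ inj₂-injective
    ... | no _   | yes _   | no v₃≢u₃  = otherLayer-≢₁ v∈X u∈X v₃≢u₃ ∘ inj₁-injective

    fixed-otherLayer : ∀ {u w} → u ∈ X → w ∈ X → f₃ u ≢ f₃ w → fixed u ≢ fixed w
    fixed-otherLayer {u} {w} u∈X w∈X u₃≢w₃ with horizontal? u | horizontal? w
    ... | yes _ | yes _ = otherLayer-≢₂ u∈X w∈X u₃≢w₃ ∘ inj₂-injective
    ... | yes _ | no _  = λ ()
    ... | no _  | yes _ = λ ()
    ... | no _  | no _  = otherLayer-≢₁ u∈X w∈X u₃≢w₃ ∘ inj₁-injective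

    horizontal⇒varying≢inj₂ : ∀ {v b} → Horizontal v → varying v ≢ inj₂ b
    horizontal⇒varying≢inj₂ {v} hv with horizontal? v
    ... | yes _  = λ ()
    ... | no ¬hv = ⊥-elim (¬hv hv)

    vertical⇒varying≢inj₁ : ∀ {v a} → ¬ Horizontal v → varying v ≢ inj₁ a
    vertical⇒varying≢inj₁ {v} ¬hv with horizontal? v
    ... | yes hv = ⊥-elim (¬hv hv)
    ... | no _   = λ ()

    oneLayer-spare : 2 ≤ m₁ → 2 ≤ m₂ → ∀ {u} → u ∈ X → (∀ {v} → v ∈ X → f₃ v ≡ f₃ u) →
      ∃[ β ] (fixed u ≢ β × ∀ {v} → v ∈ X → varying v ≢ β)
    oneLayer-spare 2≤m₁ 2≤m₂ {u} u∈X oneLayer with horizontal? u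
    ... | yes hu =
      let b , b≢u₂ = another 2≤m₂ (f₂ u)
      in inj₂ b , (λ u₂≡b → b≢u₂ (sym (inj₂-injective u₂≡b))) ,
         λ v∈X → horizontal⇒varying≢inj₂ (horizontal-layer hu v∈X (oneLayer v∈X))
    ... | no ¬hu =
      let a , a≢u₁ = another 2≤m₁ (f₁ u)
      in inj₁ a , (λ u₁≡a → a≢u₁ (sym (inj₁-injective u₁≡a))) ,
         λ v∈X → vertical⇒varying≢inj₁ (λ hv → ¬hu (horizontal-layer hv u∈X (sym (oneLayer v∈X))))

    two-missing⇒bound : Unique X → ∀ {a b} → a ≢ b →
      (∀ {v} → v ∈ X → varying v ≢ a) → (∀ {v} → v ∈ X → varying v ≢ b) → 2 + length X ≤ m₁ + m₂
    two-missing⇒bound uX a≢b ∌a ∌b =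
      subst (λ k → 2 + k ≤ m₁ + m₂) (length-map varying X)
        (⊎-Unique⇒length≤ ((a≢b ∷ missing ∌a) ∷ missing ∌b ∷ Unique-map⁺-on varying-injective uX))
      where
      missing : ∀ {a} → (∀ {v} → v ∈ X → varying v ≢ a) → All (a ≢_) (map varying X)
      missing ∌a = All.map⁺ (All.tabulate (≢-sym ∘ ∌a))

    length-bound : Unique X → 2 ≤ m₁ → 2 ≤ m₂ → 2 + length X ≤ m₁ + m₂
    length-bound uX 2≤m₁ 2≤m₂ with []⊎∈ X
    ... | inj₁ X≡[] = subst (λ Y → 2 + length Y ≤ m₁ + m₂) (sym X≡[]) (≤-trans 2≤m₁ (m≤m+n m₁ m₂))
    ... | inj₂ (u , u∈X) with all? (λ v → f₃ v ≟ f₃ u) X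
    ...   | yes oneLayer =
      let β , u≢β , ∌β = oneLayer-spare 2≤m₁ 2≤m₂ u∈X (All.lookup oneLayer)
      in two-missing⇒bound uX u≢β (varying≢fixed u∈X) ∌β
    ...   | no ¬oneLayer =
      let w , w∈X , w₃≢u₃ = find (All.¬All⇒Any¬ (λ v → f₃ v ≟ f₃ u) X ¬oneLayer)
      in two-missing⇒bound uX (fixed-otherLayer u∈X w∈X (≢-sym w₃≢u₃))
           (varying≢fixed u∈X) (varying≢fixed w∈X)

open NoSingleAgreementProperties using (no-three-edge-directions; length-bound)

module CliqueProduct (n₁ n₂ n₃ : ℕ) where

  H : Graph
  H = K n₁ □ K n₂ □ K n₃

  c₁ : V H → Fin n₁
  c₁ ((a , _) , _) = a

  c₂ : V H → Fin n₂
  c₂ ((_ , b) , _) = b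

  c₃ : V H → Fin n₃
  c₃ (_ , c) = c

  coords-≡ : ∀ {u w} → c₁ u ≡ c₁ w → c₂ u ≡ c₂ w → c₃ u ≡ c₃ w → u ≡ w
  coords-≡ {(_ , _) , _} refl refl refl = refl

  _≟V_ : (u w : V H) → Dec (u ≡ w)
  _≟V_ = ≡-dec (≡-dec _≟_ _≟_) _≟_

  open import Data.List.Membership.DecPropositional _≟V_ using (_∈?_)

  hamming : DistanceLowerBound H
  hamming = □-distance (□-distance K-distance K-distance) K-distance

  hamming-≥ : ∀ {a a' b b' c c' k₁ k₂ k₃} → k₁ ≤ δ a a' → k₂ ≤ δ b b' → k₃ ≤ δ c c' →
    k₁ + k₂ + k₃ ≤ dist hamming ((a , b) , c) ((a' , b') , c')
  hamming-≥ k₁≤ k₂≤ k₃≤ = +-mono-≤ (+-mono-≤ k₁≤ k₂≤) k₃≤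

  edge₁ : ∀ {a a' b c} → a ≢ a' → Adj H ((a , b) , c) ((a' , b) , c)
  edge₁ a≢a' = inj₁ (inj₁ (a≢a' , refl) , refl)

  edge₂ : ∀ {a b b' c} → b ≢ b' → Adj H ((a , b) , c) ((a , b') , c)
  edge₂ b≢b' = inj₁ (inj₂ (refl , b≢b') , refl)

  edge₃ : ∀ {a b c c'} → c ≢ c' → Adj H ((a , b) , c) ((a , b) , c')
  edge₃ c≢c' = inj₂ (refl , c≢c')

  tmv⇒noSingleAgreement : ∀ {X} → IsTotalMutualVisibilitySet H X → NoSingleAgreement c₁ c₂ c₃ X
  tmv⇒noSingleAgreement tmv {(a , b) , c} {(a , b') , c'} u∈X w∈X (only₁ refl b≢b' c≢c') =
    □-corners-invisible (inj₂ (refl , b≢b')) (≢-sym c≢c') (b≢b' ∘ cong proj₂) c≢c' u∈X w∈X (tmv _ _)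
  tmv⇒noSingleAgreement tmv {(a , b) , c} {(a' , b) , c'} u∈X w∈X (only₂ a≢a' refl c≢c') =
    □-corners-invisible (inj₁ (a≢a' , refl)) (≢-sym c≢c') (a≢a' ∘ cong proj₁) c≢c' u∈X w∈X (tmv _ _)
  tmv⇒noSingleAgreement {X} tmv {(a , b) , c} {(a' , b') , c} u∈X w∈X (only₃ a≢a' b≢b' refl) =
    ¬visible-via-common-neighbours (a≢a' ∘ cong (proj₁ ∘ proj₁))
      (□-¬adj-layer {K n₁ □ K n₂} {K n₃} (a≢a' ∘ cong proj₁) ab'≁a'b)
      (edge₂ (≢-sym b≢b')) (edge₁ a≢a') common (tmv _ _)
    where
    ab'≁a'b : ¬ Adj (K n₁ □ K n₂) (a , b') (a' , b)
    ab'≁a'b = □-¬adj {K n₁} {K n₂} a≢a' (≢-sym b≢b')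
    corner∈X : ∀ {z} → z ≡ (a , b) ⊎ z ≡ (a' , b') → (z , c) ∈ X
    corner∈X (inj₁ refl) = u∈X
    corner∈X (inj₂ refl) = w∈X
    common : ∀ {z} → Adj H ((a , b') , c) z → Adj H z ((a' , b) , c) → z ∈ X
    common x~z z~y with □-common-neighbour-layer {K n₁ □ K n₂} {K n₃} (a≢a' ∘ cong proj₁) ab'≁a'b x~z z~y
    ... | _ , refl , x~z' , z'~y = corner∈X (□-common-neighbour {K n₁} {K n₂} a≢a' b≢b' x~z' z'~y)

  module _ {X : List (V H)} (free : NoSingleAgreement c₁ c₂ c₃ X) where

    visible-along : ∀ {x y} (p : Walk H x y) → walkLength H p ≤ dist hamming x y →
      All (_∉ X) (internal H p) → Visible H X x y
    visible-along p p≤dist avoids = p , isShortest hamming p p≤dist , λ v → All.lookup avoids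

    avoid-one : ∀ {u w} → (u ∈ X → w ∈ X → ⊥) → u ∉ X ⊎ w ∉ X
    avoid-one {u} clash with u ∈? X
    ... | no  u∉X = inj₁ u∉X
    ... | yes u∈X = inj₂ (clash u∈X)

    visible-via-square : ∀ {x u w y} → Adj H x u → Adj H u y → Adj H x w → Adj H w y →
      2 ≤ dist hamming x y → (u ∈ X → w ∈ X → ⊥) → Visible H X x y
    visible-via-square x~u u~y x~w w~y 2≤dist clash with avoid-one clash
    ... | inj₁ u∉X = visible-along (x~u ∷ u~y ∷ []) 2≤dist (u∉X ∷ [])
    ... | inj₂ w∉X = visible-along (x~w ∷ w~y ∷ []) 2≤dist (w∉X ∷ [])

    -- A route changing the coordinates one at a time first visits one of the three
    -- neighbours of x towards y and then one of the three neighbours of y towards x;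
    -- any two neighbours in either triple differ in exactly two coordinates.
    visible-three-apart : ∀ {a a' b b' c c'} → a ≢ a' → b ≢ b' → c ≢ c' →
      Visible H X ((a , b) , c) ((a' , b') , c')
    visible-three-apart {a} {a'} {b} {b'} {c} {c'} a≢a' b≢b' c≢c' =
      [ via-p₁ , via-p₂ ]′ (avoid-one λ p₁∈X p₂∈X → free p₁∈X p₂∈X (only₃ (≢-sym a≢a') b≢b' refl))
      where
      3≤dist : 3 ≤ dist hamming ((a , b) , c) ((a' , b') , c')
      3≤dist = hamming-≥ (δ-≢ a≢a') (δ-≢ b≢b') (δ-≢ c≢c')

      via-p₁ : ((a' , b) , c) ∉ X → Visible H X ((a , b) , c) ((a' , b') , c')
      via-p₁ p₁∉X =
        [ (λ p₁₂∉X → visible-along (edge₁ a≢a' ∷ edge₂ b≢b' ∷ edge₃ c≢c' ∷ []) 3≤dist (p₁∉X ∷ p₁₂∉X ∷ []))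
        , (λ p₁₃∉X → visible-along (edge₁ a≢a' ∷ edge₃ c≢c' ∷ edge₂ b≢b' ∷ []) 3≤dist (p₁∉X ∷ p₁₃∉X ∷ []))
        ]′ (avoid-one λ p₁₂∈X p₁₃∈X → free p₁₂∈X p₁₃∈X (only₁ refl (≢-sym b≢b') c≢c'))

      via-p₂ : ((a , b') , c) ∉ X → Visible H X ((a , b) , c) ((a' , b') , c')
      via-p₂ p₂∉X =
        [ (λ p₁₂∉X → visible-along (edge₂ b≢b' ∷ edge₁ a≢a' ∷ edge₃ c≢c' ∷ []) 3≤dist (p₂∉X ∷ p₁₂∉X ∷ []))
        , (λ p₂₃∉X → visible-along (edge₂ b≢b' ∷ edge₃ c≢c' ∷ edge₁ a≢a' ∷ []) 3≤dist (p₂∉X ∷ p₂₃∉X ∷ []))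
        ]′ (avoid-one λ p₁₂∈X p₂₃∈X → free p₁₂∈X p₂₃∈X (only₂ (≢-sym a≢a') refl c≢c'))

    noSingleAgreement⇒tmv : IsTotalMutualVisibilitySet H X
    noSingleAgreement⇒tmv ((a , b) , c) ((a' , b') , c') with a ≟ a' | b ≟ b' | c ≟ c'
    ... | yes refl | yes refl | yes refl = visible-along [] z≤n []
    ... | no a≢a'  | yes refl | yes refl =
      visible-along (edge₁ a≢a' ∷ []) (hamming-≥ (δ-≢ a≢a') z≤n z≤n) []
    ... | yes refl | no b≢b'  | yes refl =
      visible-along (edge₂ b≢b' ∷ []) (hamming-≥ (z≤n {δ a a}) (δ-≢ b≢b') z≤n) []
    ... | yes refl | yes refl | no c≢c'  =
      visible-along (edge₃ c≢c' ∷ []) (hamming-≥ (z≤n {δ a a}) z≤n (δ-≢ c≢c')) []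
    ... | no a≢a'  | no b≢b'  | yes refl =
      visible-via-square (edge₁ a≢a') (edge₂ b≢b') (edge₂ b≢b') (edge₁ a≢a')
        (hamming-≥ (δ-≢ a≢a') (δ-≢ b≢b') z≤n) (λ u∈X w∈X → free u∈X w∈X (only₃ (≢-sym a≢a') b≢b' refl))
    ... | no a≢a'  | yes refl | no c≢c'  =
      visible-via-square (edge₁ a≢a') (edge₃ c≢c') (edge₃ c≢c') (edge₁ a≢a')
        (hamming-≥ (δ-≢ a≢a') z≤n (δ-≢ c≢c')) (λ u∈X w∈X → free u∈X w∈X (only₂ (≢-sym a≢a') refl c≢c'))
    ... | yes refl | no b≢b'  | no c≢c'  =
      visible-via-square (edge₂ b≢b') (edge₃ c≢c') (edge₃ c≢c') (edge₂ b≢b')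
        (hamming-≥ z≤n (δ-≢ b≢b') (δ-≢ c≢c')) (λ u∈X w∈X → free u∈X w∈X (only₁ refl (≢-sym b≢b') c≢c'))
    ... | no a≢a'  | no b≢b'  | no c≢c'  = visible-three-apart a≢a' b≢b' c≢c'

  tmv-length-bound : 2 ≤ n₃ → n₃ ≤ 3 → n₃ ≤ n₂ → n₂ ≤ n₁ → ∀ {X} → Unique X →
    IsTotalMutualVisibilitySet H X → 2 + length X ≤ n₁ + n₂
  tmv-length-bound 2≤n₃ n₃≤3 n₃≤n₂ n₂≤n₁ {X} uX tmv =
    [ bound₁₂ , (λ along₃ → [ bound₁₃ , bound₂₃ along₃ ]′ (noEdgeAlong-or-edgeAlong c₁ c₃ c₂ X)) ]′
      (noEdgeAlong-or-edgeAlong c₁ c₂ c₃ X)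
    where
    free : NoSingleAgreement c₁ c₂ c₃ X
    free = tmv⇒noSingleAgreement tmv

    2≤n₂ : 2 ≤ n₂
    2≤n₂ = ≤-trans 2≤n₃ n₃≤n₂

    bound₁₂ : NoEdgeAlong c₁ c₂ c₃ X → 2 + length X ≤ n₁ + n₂
    bound₁₂ noEdge₃ =
      length-bound free (λ u∈X w∈X u₁≡w₁ u₂≡w₂ → coords-≡ u₁≡w₁ u₂≡w₂ (noEdge₃ u∈X w∈X u₁≡w₁ u₂≡w₂))
        uX (≤-trans 2≤n₂ n₂≤n₁) 2≤n₂

    bound₁₃ : NoEdgeAlong c₁ c₃ c₂ X → 2 + length X ≤ n₁ + n₂
    bound₁₃ noEdge₂ = ≤-trans
      (length-bound (NoSingleAgreement-swap₂₃ free)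
        (λ u∈X w∈X u₁≡w₁ u₃≡w₃ → coords-≡ u₁≡w₁ (noEdge₂ u∈X w∈X u₁≡w₁ u₃≡w₃) u₃≡w₃)
        uX (≤-trans 2≤n₂ n₂≤n₁) 2≤n₃)
      (+-monoʳ-≤ n₁ n₃≤n₂)

    bound₂₃ : EdgeAlong c₁ c₂ c₃ X → EdgeAlong c₁ c₃ c₂ X → 2 + length X ≤ n₁ + n₂
    bound₂₃ along₃ along₂ = ≤-trans
      (length-bound (NoSingleAgreement-rotate free) injective₂₃ uX 2≤n₂ 2≤n₃)
      (+-mono-≤ n₂≤n₁ n₃≤n₂)
      where
      injective₂₃ : ∀ {u w} → u ∈ X → w ∈ X → c₂ u ≡ c₂ w → c₃ u ≡ c₃ w → u ≡ w
      injective₂₃ {u} {w} u∈X w∈X u₂≡w₂ u₃≡w₃ with c₁ u ≟ c₁ w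
      ... | yes u₁≡w₁ = coords-≡ u₁≡w₁ u₂≡w₂ u₃≡w₃
      ... | no  u₁≢w₁ = ⊥-elim (no-three-edge-directions free n₃≤3 along₃ along₂
                                 (u , w , u∈X , w∈X , u₂≡w₂ , u₃≡w₃ , u₁≢w₁))

module Construction (k₁ k₂ k₃ : ℕ) where
  open CliqueProduct (suc k₁) (suc k₂) (suc (suc k₃))

  row : Fin k₁ → V H
  row i = (suc i , zero) , zero

  column : Fin k₂ → V H
  column j = (zero , suc j) , suc zero

  X₀ : List (V H)
  X₀ = map row (allFin k₁) ++ map column (allFin k₂)

  X₀-members : ∀ {v} → v ∈ X₀ → (∃[ i ] v ≡ row i) ⊎ (∃[ j ] v ≡ column j)
  X₀-members v∈X₀ with ∈-++⁻ (map row (allFin k₁)) v∈X₀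
  ... | inj₁ v∈rows    = let i , _ , v≡row = ∈-map⁻ row v∈rows in inj₁ (i , v≡row)
  ... | inj₂ v∈columns = let j , _ , v≡col = ∈-map⁻ column v∈columns in inj₂ (j , v≡col)

  X₀-unique : Unique X₀
  X₀-unique = ++⁺ (Unique.map⁺ (suc-injective ∘ cong c₁) (allFin⁺ k₁))
                  (Unique.map⁺ (suc-injective ∘ cong c₂) (allFin⁺ k₂))
                  (λ (v∈rows , v∈columns) → row≢column (∈-map⁻ row v∈rows) (∈-map⁻ column v∈columns))
    where
    row≢column : ∀ {v} → ∃[ i ] (i ∈ allFin k₁ × v ≡ row i) → ∃[ j ] (j ∈ allFin k₂ × v ≡ column j) → ⊥
    row≢column (_ , _ , refl) (_ , _ , ())

  X₀-length : length X₀ ≡ suc k₁ + suc k₂ ∸ 2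
  X₀-length = begin
    length X₀                                         ≡⟨ length-++ (map row (allFin k₁)) ⟩
    length (map row (allFin k₁)) + length (map column (allFin k₂))
      ≡⟨ cong₂ _+_ (length-map row (allFin k₁)) (length-map column (allFin k₂)) ⟩
    length (allFin k₁) + length (allFin k₂)
      ≡⟨ cong₂ _+_ (length-tabulate {n = k₁} id) (length-tabulate {n = k₂} id) ⟩
    k₁ + k₂                                           ≡⟨ cong (_∸ 1) (+-suc k₁ k₂) ⟨
    suc k₁ + suc k₂ ∸ 2                               ∎
    where open ≡-Reasoning

  X₀-noSingleAgreement : NoSingleAgreement c₁ c₂ c₃ X₀
  X₀-noSingleAgreement u∈X₀ w∈X₀ with X₀-members u∈X₀ | X₀-members w∈X₀
  ... | inj₁ (_ , refl) | inj₁ (_ , refl) =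
    λ { (only₁ _ ¬q _) → ¬q refl ; (only₂ _ _ ¬r) → ¬r refl ; (only₃ _ ¬q _) → ¬q refl }
  ... | inj₂ (_ , refl) | inj₂ (_ , refl) =
    λ { (only₁ _ _ ¬r) → ¬r refl ; (only₂ ¬p _ _) → ¬p refl ; (only₃ ¬p _ _) → ¬p refl }
  ... | inj₁ (_ , refl) | inj₂ (_ , refl) = λ { (only₁ () _ _) ; (only₂ _ () _) ; (only₃ _ _ ()) }
  ... | inj₂ (_ , refl) | inj₁ (_ , refl) = λ { (only₁ () _ _) ; (only₂ _ () _) ; (only₃ _ _ ()) }

tmv-number : ∀ {n₁ n₂ n₃} → 2 ≤ n₃ → n₃ ≤ 3 → n₃ ≤ n₂ → n₂ ≤ n₁ →
  TotalMutualVisibilityNumber (K n₁ □ K n₂ □ K n₃) (n₁ + n₂ ∸ 2)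
tmv-number {suc k₁} {suc k₂} {suc (suc k₃)} 2≤n₃@(s≤s (s≤s _)) n₃≤3 n₃≤n₂@(s≤s _) n₂≤n₁@(s≤s _) =
  (X₀ , X₀-unique , noSingleAgreement⇒tmv X₀-noSingleAgreement , X₀-length) ,
  λ X uX tmv → ∸-monoˡ-≤ 2 (tmv-length-bound 2≤n₃ n₃≤3 n₃≤n₂ n₂≤n₁ uX tmv)
  where
  open CliqueProduct (suc k₁) (suc k₂) (suc (suc k₃))
  open Construction k₁ k₂ k₃

theorem3p2 : (n₁ n₂ n₃ : ℕ) → n₂ ≤ n₁ → n₃ ≤ n₂ → (n₃ ≡ 2 ⊎ n₃ ≡ 3) →
    TotalMutualVisibilityNumber (K n₁ □ K n₂ □ K n₃) (n₁ + n₂ ∸ 2)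
theorem3p2 n₁ n₂ .2 n₂≤n₁ n₃≤n₂ (inj₁ refl) = tmv-number (s≤s (s≤s z≤n)) (s≤s (s≤s z≤n)) n₃≤n₂ n₂≤n₁
theorem3p2 n₁ n₂ .3 n₂≤n₁ n₃≤n₂ (inj₂ refl) = tmv-number (s≤s (s≤s z≤n)) ≤-refl n₃≤n₂ n₂≤n₁
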